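{- Let $n\equiv 2\pmod 4$. Then every simple graph on $n$ vertices in which every vertex has odd degree and $|N(i)\cap N(j)|$ is even for all distinct vertices $i,j$ has at least one vertex whose degree is congruent to $1\pmod 4$.
   Context: $N(v)$ is the neighbor set of $v$ and the degree of $v$ is $|N(v)|$. -}

module Defs where

open import Data.Nat using (ℕ)
open import Data.Bool using (Bool; true; false; _∧_)
open import Data.Fin using (Fin)
open import Data.List using (List; length; filterᵇ; allFin)
open import Relation.Binary.PropositionalEquality using (_≡_)
open import Relation.Nullary using (¬_)

record SimpleGraph (n : ℕ) : Set where
  field
    adj   : Fin n → Fin n → Bool
    sym   : ∀ i j → adj i j ≡ adj j i
    irrefl : ∀ i → adj i i ≡ false
open SimpleGraph public

nbrs : ∀ {n} → SimpleGraph n → Fin n → List (Fin n)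
nbrs G v = filterᵇ (adj G v) (allFin _)

degree : ∀ {n} → SimpleGraph n → Fin n → ℕ
degree G v = length (nbrs G v)

commonNbrs : ∀ {n} → SimpleGraph n → Fin n → Fin n → ℕ
commonNbrs G i j = length (filterᵇ (λ k → adj G i k ∧ adj G j k) (allFin _))

-- Let A be the adjacency matrix. Modulo 2 the hypotheses say A Aᵀ = A² = I, so y ↦ yA is an
-- involution of 𝔽₂ⁿ (vectors as subsets). If no degree were 1 mod 4, every diagonal entry of A Aᵀ
-- would be 3 mod 4; since m² mod 4 = m mod 2, |yA| ≡ ∑ₖ (yA)ₖ² = y A Aᵀ yᵀ ≡ 3|y| (mod 4), the
-- off-diagonal terms pairing up into multiples of 4. Then i^|yA| is the conjugate of i^|y|, and
-- reindexing ∑_y i^|y| = (1+i)ⁿ along the involution shows that (1+i)ⁿ is real. But for n ≡ 2 (mod 4)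
-- it is ±2^(n/2)·i.

module Submission where

open import Defs renaming (sym to adj-sym)
open import Data.Bool as Bool using (Bool; true; false; _∧_; if_then_else_)
open import Data.Fin using (Fin; zero; suc)
open import Data.Fin.Properties using (_≟_; any?; suc-injective)
open import Data.Fin.Subset using (Subset; inside; outside; ∣_∣)
open import Data.Integer as ℤ using (ℤ)
import Data.Integer.Properties as ℤ
import Data.Integer.Tactic.RingSolver as ℤ-Solver
open import Data.List using (length; filterᵇ)
import Data.List as List
open import Data.Nat as ℕ using (ℕ; zero; suc; _+_; _*_; _≡ᵇ_; _<_; s≤s; z≤n; NonZero)
open import Data.Nat.Divisibility using (_∣_; divides; _∣0; ∣m∣n⇒∣m+n; ∣n⇒∣m*n; m%n≡0⇒n∣m)
open import Data.Nat.DivMod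
  using (_%_; %-distribˡ-+; %-distribˡ-*; m%n<n; m%n%n≡m%n; m<n⇒m%n≡m; [m+n]%n≡m%n; [m+kn]%n≡m%n;
         m∣n⇒o%n%m≡o%m)
open import Data.Nat.Properties
  using (≤-trans; +-identityʳ; *-identityʳ; *-zeroʳ; +-*-semiring; *-assoc; *-comm; +-comm)
import Data.Nat.Tactic.RingSolver as ℕ-Solver
open import Data.Product using (∃; _,_)
open import Data.Vec using ([]; _∷_; lookup; tabulate)
open import Data.Vec.Properties using (≡-dec; lookup∘tabulate; tabulate∘lookup; tabulate-cong)
open import Function using (_∘_; id)
open import Function.Bundles using (Inverse; _↔_; mk↔ₛ′)
open import Relation.Binary.Definitions using (DecidableEquality)
open import Relation.Binary.PropositionalEquality hiding ([_])
open import Relation.Nullary using (yes; no; does; contradiction)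

open import Algebra.Properties.Semiring.Sum +-*-semiring
  using (sum; sum-syntax; sum-cong-≗; ∑-distrib-+; ∑-comm; *-distribˡ-sum; *-distribʳ-sum;
         sum-replicate-zero)
open ≡-Reasoning

𝟙 : Bool → ℕ
𝟙 true  = 1
𝟙 false = 0

𝟙-idem : ∀ b → 𝟙 b * 𝟙 b ≡ 𝟙 b
𝟙-idem true  = refl
𝟙-idem false = refl

𝟙-∧ : ∀ a b → 𝟙 (a ∧ b) ≡ 𝟙 a * 𝟙 b
𝟙-∧ true  b = sym (+-identityʳ (𝟙 b))
𝟙-∧ false b = refl

module _ {d : ℕ} .{{_ : NonZero d}} where

  +-mod-cong : ∀ {a b c e} → a % d ≡ b % d → c % d ≡ e % d → (a + c) % d ≡ (b + e) % d
  +-mod-cong {a} {b} {c} {e} a≡b c≡e = begin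
    (a + c) % d          ≡⟨ %-distribˡ-+ a c d ⟩
    (a % d + c % d) % d  ≡⟨ cong₂ (λ x y → (x + y) % d) a≡b c≡e ⟩
    (b % d + e % d) % d  ≡⟨ %-distribˡ-+ b e d ⟨
    (b + e) % d          ∎

  *-mod-cong : ∀ {a b c e} → a % d ≡ b % d → c % d ≡ e % d → (a * c) % d ≡ (b * e) % d
  *-mod-cong {a} {b} {c} {e} a≡b c≡e = begin
    (a * c) % d          ≡⟨ %-distribˡ-* a c d ⟩
    (a % d * (c % d)) % d  ≡⟨ cong₂ (λ x y → (x * y) % d) a≡b c≡e ⟩
    (b % d * (e % d)) % d  ≡⟨ %-distribˡ-* b e d ⟨
    (b * e) % d          ∎

  sum-mod-cong : ∀ {n} {f g : Fin n → ℕ} → (∀ i → f i % d ≡ g i % d) → sum f % d ≡ sum g % d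
  sum-mod-cong {zero}  _   = refl
  sum-mod-cong {suc n} f≡g = +-mod-cong (f≡g zero) (sum-mod-cong (f≡g ∘ suc))

∣-sum : ∀ {d n} {f : Fin n → ℕ} → (∀ i → d ∣ f i) → d ∣ sum f
∣-sum {d} {zero}  _   = d ∣0
∣-sum {d} {suc n} d∣f = ∣m∣n⇒∣m+n (d∣f zero) (∣-sum (d∣f ∘ suc))

m%4%2≡m%2 : ∀ m → m % 4 % 2 ≡ m % 2
m%4%2≡m%2 m = m∣n⇒o%n%m≡o%m 2 4 m (divides 2 refl)

m*m%4≡m%2 : ∀ m → (m * m) % 4 ≡ m % 2
m*m%4≡m%2 m = begin
  (m * m) % 4            ≡⟨ %-distribˡ-* m m 4 ⟩
  (m % 4 * (m % 4)) % 4  ≡⟨ residue (m % 4) (m%n<n m 4) ⟩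
  m % 4 % 2              ≡⟨ m%4%2≡m%2 m ⟩
  m % 2                  ∎
  where
  residue : ∀ r → r < 4 → (r * r) % 4 ≡ r % 2
  residue 0 _ = refl
  residue 1 _ = refl
  residue 2 _ = refl
  residue 3 _ = refl
  residue (suc (suc (suc (suc _)))) (s≤s (s≤s (s≤s (s≤s ()))))

m%2≡1∧m%4≢1⇒m%4≡3 : ∀ m → m % 2 ≡ 1 → m % 4 ≢ 1 → m % 4 ≡ 3
m%2≡1∧m%4≢1⇒m%4≡3 m m-odd = residue (m % 4) (m%n<n m 4) (trans (m%4%2≡m%2 m) m-odd)
  where
  residue : ∀ r → r < 4 → r % 2 ≡ 1 → r ≢ 1 → r ≡ 3
  residue 1 _ _ r≢1 = contradiction refl r≢1
  residue 3 _ _ _   = refl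
  residue (suc (suc (suc (suc _)))) (s≤s (s≤s (s≤s (s≤s ()))))

m%4≡3⇒m%2≡1 : ∀ m → m % 4 ≡ 3 → m % 2 ≡ 1
m%4≡3⇒m%2≡1 m m≡3 = trans (sym (m%4%2≡m%2 m)) (cong (_% 2) m≡3)

[m+2*r]%4≡m%4 : ∀ m {r} → 2 ∣ r → (m + 2 * r) % 4 ≡ m % 4
[m+2*r]%4≡m%4 m (divides q refl) =
  trans (cong (λ x → (m + x) % 4) (2*[q*2]≡q*4 q)) ([m+kn]%n≡m%n m q 4)
  where
  2*[q*2]≡q*4 : ∀ q → 2 * (q * 2) ≡ q * 4
  2*[q*2]≡q*4 = ℕ-Solver.solve-∀

isOdd : ℕ → Bool
isOdd m = m % 2 ≡ᵇ 1

𝟙-isOdd : ∀ m → 𝟙 (isOdd m) ≡ m % 2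
𝟙-isOdd m = residue (m % 2) (m%n<n m 2)
  where
  residue : ∀ r → r < 2 → 𝟙 (r ≡ᵇ 1) ≡ r
  residue 0 _ = refl
  residue 1 _ = refl
  residue (suc (suc _)) (s≤s (s≤s ()))

isOdd-𝟙 : ∀ b → isOdd (𝟙 b) ≡ b
isOdd-𝟙 true  = refl
isOdd-𝟙 false = refl

∑∑%4≡trace%4 : ∀ {n} (g : Fin n → Fin n → ℕ) → (∀ u v → g u v ≡ g v u) →
  (∀ u v → u ≢ v → 2 ∣ g u v) →
  (∑[ u < n ] ∑[ v < n ] g u v) % 4 ≡ (∑[ u < n ] g u u) % 4
∑∑%4≡trace%4 {zero}  g g-sym g-even = refl
∑∑%4≡trace%4 {suc n} g g-sym g-even = begin
  (g₀₀ + r + ∑[ u < n ] (g (suc u) zero + ∑[ v < n ] g (suc u) (suc v))) % 4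
    ≡⟨ cong (λ x → (g₀₀ + r + x) % 4) (∑-distrib-+ (λ u → g (suc u) zero) _) ⟩
  (g₀₀ + r + (∑[ u < n ] g (suc u) zero + rest)) % 4
    ≡⟨ cong (λ x → (g₀₀ + r + (x + rest)) % 4) (sum-cong-≗ (λ u → g-sym (suc u) zero)) ⟩
  (g₀₀ + r + (r + rest)) % 4
    ≡⟨ cong (_% 4) (regroup g₀₀ r rest) ⟩
  (g₀₀ + rest + 2 * r) % 4
    ≡⟨ [m+2*r]%4≡m%4 (g₀₀ + rest) (∣-sum (λ v → g-even zero (suc v) λ ())) ⟩
  (g₀₀ + rest) % 4
    ≡⟨ +-mod-cong {a = g₀₀} {b = g₀₀} refl (∑∑%4≡trace%4 g′ (λ u v → g-sym (suc u) (suc v))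
                                     (λ u v u≢v → g-even (suc u) (suc v) (u≢v ∘ suc-injective))) ⟩
  (g₀₀ + ∑[ u < n ] g′ u u) % 4 ∎
  where
  g′ : Fin n → Fin n → ℕ
  g′ u v = g (suc u) (suc v)
  g₀₀ r rest : ℕ
  g₀₀ = g zero zero
  r = ∑[ v < n ] g zero (suc v)
  rest = ∑[ u < n ] ∑[ v < n ] g′ u v
  regroup : ∀ a b c → a + b + (b + c) ≡ a + c + 2 * b
  regroup = ℕ-Solver.solve-∀

δ : ∀ {n} → Fin n → Fin n → ℕ
δ u v = if does (u ≟ v) then 1 else 0

_·_ : ∀ {n} → (Fin n → ℕ) → (Fin n → Fin n → ℕ) → Fin n → ℕ
(x · M) k = ∑[ u < _ ] (x u * M u k)

gram : ∀ {n} → (Fin n → Fin n → ℕ) → Fin n → Fin n → ℕ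
gram A u v = ∑[ k < _ ] (A u k * A v k)

gram-sym : ∀ {n} (A : Fin n → Fin n → ℕ) u v → gram A u v ≡ gram A v u
gram-sym A u v = sum-cong-≗ (λ k → *-comm (A u k) (A v k))

·-identityʳ : ∀ {n} (x : Fin n → ℕ) k → (x · δ) k ≡ x k
·-identityʳ {suc n} x zero = begin
  x zero * 1 + ∑[ u < n ] (x (suc u) * 0)
    ≡⟨ cong₂ _+_ (*-identityʳ (x zero)) (sum-cong-≗ (*-zeroʳ ∘ x ∘ suc)) ⟩
  x zero + ∑[ u < n ] 0
    ≡⟨ cong (x zero +_) (sum-replicate-zero n) ⟩
  x zero + 0
    ≡⟨ +-identityʳ (x zero) ⟩
  x zero ∎
·-identityʳ {suc n} x (suc k) = cong₂ _+_ (*-zeroʳ (x zero)) (·-identityʳ (x ∘ suc) k)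

·-·-symmetric : ∀ {n} (A : Fin n → Fin n → ℕ) → (∀ u v → A u v ≡ A v u) →
  ∀ x k → ((x · A) · A) k ≡ (x · gram A) k
·-·-symmetric {n} A A-sym x k = begin
  ∑[ v < n ] (∑[ u < n ] (x u * A u v) * A v k)
    ≡⟨ sum-cong-≗ (λ v → *-distribʳ-sum (A v k) (λ u → x u * A u v)) ⟩
  ∑[ v < n ] ∑[ u < n ] (x u * A u v * A v k)
    ≡⟨ ∑-comm (λ v u → x u * A u v * A v k) ⟩
  ∑[ u < n ] ∑[ v < n ] (x u * A u v * A v k)
    ≡⟨ sum-cong-≗ (λ u → sum-cong-≗ (λ v → reassoc u v)) ⟩
  ∑[ u < n ] ∑[ v < n ] (x u * (A u v * A k v))
    ≡⟨ sum-cong-≗ (λ u → *-distribˡ-sum (x u) (λ v → A u v * A k v)) ⟨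
  ∑[ u < n ] (x u * gram A u k) ∎
  where
  reassoc : ∀ u v → x u * A u v * A v k ≡ x u * (A u v * A k v)
  reassoc u v = trans (*-assoc (x u) _ _) (cong (λ a → x u * (A u v * a)) (A-sym v k))

∑·²≡∑∑gram : ∀ {n} (A : Fin n → Fin n → ℕ) x →
  ∑[ k < n ] ((x · A) k * (x · A) k) ≡ ∑[ u < n ] ∑[ v < n ] (x u * x v * gram A u v)
∑·²≡∑∑gram {n} A x = begin
  ∑[ k < n ] ((x · A) k * (x · A) k)            ≡⟨ sum-cong-≗ expand ⟩
  ∑[ k < n ] ∑[ u < n ] ∑[ v < n ] term u v k   ≡⟨ ∑-comm (λ k u → ∑[ v < n ] term u v k) ⟩
  ∑[ u < n ] ∑[ k < n ] ∑[ v < n ] term u v k   ≡⟨ sum-cong-≗ (λ u → ∑-comm (λ k v → term u v k)) ⟩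
  ∑[ u < n ] ∑[ v < n ] ∑[ k < n ] term u v k   ≡⟨ sum-cong-≗ (λ u → sum-cong-≗ (λ v → collect u v)) ⟩
  ∑[ u < n ] ∑[ v < n ] (x u * x v * gram A u v) ∎
  where
  term : Fin n → Fin n → Fin n → ℕ
  term u v k = x u * A u k * (x v * A v k)
  expand : ∀ k → (x · A) k * (x · A) k ≡ ∑[ u < n ] ∑[ v < n ] term u v k
  expand k = trans (*-distribʳ-sum ((x · A) k) (λ u → x u * A u k))
                   (sum-cong-≗ (λ u → *-distribˡ-sum (x u * A u k) (λ v → x v * A v k)))
  collect : ∀ u v → ∑[ k < n ] term u v k ≡ x u * x v * gram A u v
  collect u v = trans (sum-cong-≗ (λ k → rearrange (x u) (A u k) (x v) (A v k)))
                      (sym (*-distribˡ-sum (x u * x v) (λ k → A u k * A v k)))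
    where
    rearrange : ∀ a b c e → a * b * (c * e) ≡ a * c * (b * e)
    rearrange = ℕ-Solver.solve-∀

χ : ∀ {n} → Subset n → Fin n → ℕ
χ y u = 𝟙 (lookup y u)

∣∣≡∑χ : ∀ {n} (y : Subset n) → ∣ y ∣ ≡ ∑[ u < n ] χ y u
∣∣≡∑χ []          = refl
∣∣≡∑χ (true  ∷ y) = cong suc (∣∣≡∑χ y)
∣∣≡∑χ (false ∷ y) = ∣∣≡∑χ y

∑ˢ : ∀ n → (Subset n → ℤ) → ℤ
∑ˢ zero    f = f []
∑ˢ (suc n) f = ∑ˢ n (f ∘ (inside ∷_)) ℤ.+ ∑ˢ n (f ∘ (outside ∷_))

∑ˢ-cong : ∀ n {f g : Subset n → ℤ} → f ≗ g → ∑ˢ n f ≡ ∑ˢ n g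
∑ˢ-cong zero    f≗g = f≗g []
∑ˢ-cong (suc n) f≗g =
  cong₂ ℤ._+_ (∑ˢ-cong n (f≗g ∘ (inside ∷_))) (∑ˢ-cong n (f≗g ∘ (outside ∷_)))

∑ˢ-zero : ∀ n → ∑ˢ n (λ _ → ℤ.0ℤ) ≡ ℤ.0ℤ
∑ˢ-zero zero    = refl
∑ˢ-zero (suc n) = cong₂ ℤ._+_ (∑ˢ-zero n) (∑ˢ-zero n)

∑ˢ-distrib-+ : ∀ n (f g : Subset n → ℤ) → ∑ˢ n (λ y → f y ℤ.+ g y) ≡ ∑ˢ n f ℤ.+ ∑ˢ n g
∑ˢ-distrib-+ zero    f g = refl
∑ˢ-distrib-+ (suc n) f g = trans
  (cong₂ ℤ._+_ (∑ˢ-distrib-+ n (f ∘ (inside ∷_)) (g ∘ (inside ∷_)))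
               (∑ˢ-distrib-+ n (f ∘ (outside ∷_)) (g ∘ (outside ∷_))))
  (interchange (∑ˢ n (f ∘ (inside ∷_))) (∑ˢ n (g ∘ (inside ∷_)))
               (∑ˢ n (f ∘ (outside ∷_))) (∑ˢ n (g ∘ (outside ∷_))))
  where open import Algebra.Properties.CommutativeSemigroup ℤ.+-commutativeSemigroup using (interchange)

∑ˢ-neg : ∀ n (f : Subset n → ℤ) → ∑ˢ n (λ y → ℤ.- f y) ≡ ℤ.- ∑ˢ n f
∑ˢ-neg zero    f = refl
∑ˢ-neg (suc n) f = trans (cong₂ ℤ._+_ (∑ˢ-neg n (f ∘ (inside ∷_))) (∑ˢ-neg n (f ∘ (outside ∷_))))
                         (sym (ℤ.neg-distrib-+ (∑ˢ n (f ∘ (inside ∷_))) (∑ˢ n (f ∘ (outside ∷_)))))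

∑ˢ-comm : ∀ n m (f : Subset n → Subset m → ℤ) →
  ∑ˢ n (λ x → ∑ˢ m (f x)) ≡ ∑ˢ m (λ y → ∑ˢ n (λ x → f x y))
∑ˢ-comm zero    m f = refl
∑ˢ-comm (suc n) m f = trans
  (cong₂ ℤ._+_ (∑ˢ-comm n m (f ∘ (inside ∷_))) (∑ˢ-comm n m (f ∘ (outside ∷_))))
  (sym (∑ˢ-distrib-+ m (λ y → ∑ˢ n (λ x → f (inside ∷ x) y))
                       (λ y → ∑ˢ n (λ x → f (outside ∷ x) y))))

_≟ˢ_ : ∀ {n} → DecidableEquality (Subset n)
_≟ˢ_ = ≡-dec Bool._≟_

∑ˢ-select : ∀ n (f : Subset n → ℤ) a → ∑ˢ n (λ x → if does (x ≟ˢ a) then f x else ℤ.0ℤ) ≡ f a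
∑ˢ-select zero    f []          = refl
∑ˢ-select (suc n) f (true  ∷ a) = trans (cong₂ ℤ._+_ (∑ˢ-select n (f ∘ (inside ∷_)) a) (∑ˢ-zero n))
                                        (ℤ.+-identityʳ _)
∑ˢ-select (suc n) f (false ∷ a) = trans (cong₂ ℤ._+_ (∑ˢ-zero n) (∑ˢ-select n (f ∘ (outside ∷_)) a))
                                        (ℤ.+-identityˡ _)

∑ˢ-reindex : ∀ n (π : Subset n ↔ Subset n) (f : Subset n → ℤ) → ∑ˢ n (f ∘ Inverse.to π) ≡ ∑ˢ n f
∑ˢ-reindex n π f = begin
  ∑ˢ n (f ∘ to)
    ≡⟨ ∑ˢ-cong n (sym ∘ ∑ˢ-select n f ∘ to) ⟩
  ∑ˢ n (λ y → ∑ˢ n (λ x → if does (x ≟ˢ to y) then f x else ℤ.0ℤ))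
    ≡⟨ ∑ˢ-comm n n (λ y x → if does (x ≟ˢ to y) then f x else ℤ.0ℤ) ⟩
  ∑ˢ n (λ x → ∑ˢ n (λ y → if does (x ≟ˢ to y) then f x else ℤ.0ℤ))
    ≡⟨ ∑ˢ-cong n (λ x → ∑ˢ-cong n (λ y → cong (λ b → if b then f x else ℤ.0ℤ) (agree x y))) ⟩
  ∑ˢ n (λ x → ∑ˢ n (λ y → if does (y ≟ˢ from x) then f x else ℤ.0ℤ))
    ≡⟨ ∑ˢ-cong n (λ x → ∑ˢ-select n (λ _ → f x) (from x)) ⟩
  ∑ˢ n f ∎
  where
  open Inverse π using (to; from; strictlyInverseˡ; strictlyInverseʳ)
  agree : ∀ x y → does (x ≟ˢ to y) ≡ does (y ≟ˢ from x)
  agree x y with x ≟ˢ to y | y ≟ˢ from x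
  ... | yes _    | yes _    = refl
  ... | no _     | no _     = refl
  ... | yes x≡ty | no y≢fx  = contradiction (sym (trans (cong from x≡ty) (strictlyInverseʳ y))) y≢fx
  ... | no x≢ty  | yes y≡fx = contradiction (sym (trans (cong to y≡fx) (strictlyInverseˡ x))) x≢ty

[4+m]%4≡m%4 : ∀ m → (4 + m) % 4 ≡ m % 4
[4+m]%4≡m%4 m = trans (cong (_% 4) (+-comm 4 m)) ([m+n]%n≡m%n m 4)

re-i^ im-i^ : ℕ → ℤ
re-i^ 0 = ℤ.1ℤ
re-i^ 1 = ℤ.0ℤ
re-i^ 2 = ℤ.-1ℤ
re-i^ 3 = ℤ.0ℤ
re-i^ (suc (suc (suc (suc w)))) = re-i^ w
im-i^ 0 = ℤ.0ℤ
im-i^ 1 = ℤ.1ℤ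
im-i^ 2 = ℤ.0ℤ
im-i^ 3 = ℤ.-1ℤ
im-i^ (suc (suc (suc (suc w)))) = im-i^ w

im-i^-suc : ∀ w → im-i^ (suc w) ≡ re-i^ w
im-i^-suc 0 = refl
im-i^-suc 1 = refl
im-i^-suc 2 = refl
im-i^-suc 3 = refl
im-i^-suc (suc (suc (suc (suc w)))) = im-i^-suc w

re-i^-suc : ∀ w → re-i^ (suc w) ≡ ℤ.- im-i^ w
re-i^-suc 0 = refl
re-i^-suc 1 = refl
re-i^-suc 2 = refl
re-i^-suc 3 = refl
re-i^-suc (suc (suc (suc (suc w)))) = re-i^-suc w

im-i^-% : ∀ w → im-i^ w ≡ im-i^ (w % 4)
im-i^-% 0 = refl
im-i^-% 1 = refl
im-i^-% 2 = refl
im-i^-% 3 = refl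
im-i^-% (suc (suc (suc (suc w)))) = trans (im-i^-% w) (cong im-i^ (sym ([4+m]%4≡m%4 w)))

im-i^-cong : ∀ {a b} → a % 4 ≡ b % 4 → im-i^ a ≡ im-i^ b
im-i^-cong {a} {b} a≡b = trans (im-i^-% a) (trans (cong im-i^ a≡b) (sym (im-i^-% b)))

im-i^-*3 : ∀ w → im-i^ (w * 3) ≡ ℤ.- im-i^ w
im-i^-*3 w = begin
  im-i^ (w * 3)        ≡⟨ im-i^-cong {w * 3} {w % 4 * 3}
                            (*-mod-cong {a = w} {b = w % 4} {c = 3} {e = 3} (sym (m%n%n≡m%n w 4)) refl) ⟩
  im-i^ (w % 4 * 3)    ≡⟨ residue (w % 4) (m%n<n w 4) ⟩
  ℤ.- im-i^ (w % 4)    ≡⟨ cong ℤ.-_ (im-i^-% w) ⟨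
  ℤ.- im-i^ w          ∎
  where
  residue : ∀ r → r < 4 → im-i^ (r * 3) ≡ ℤ.- im-i^ r
  residue 0 _ = refl
  residue 1 _ = refl
  residue 2 _ = refl
  residue 3 _ = refl
  residue (suc (suc (suc (suc _)))) (s≤s (s≤s (s≤s (s≤s ()))))

-- By the binomial theorem these are the real and imaginary parts of (1+i)ⁿ.
re-[1+i]^ im-[1+i]^ : ℕ → ℤ
re-[1+i]^ n = ∑ˢ n (re-i^ ∘ ∣_∣)
im-[1+i]^ n = ∑ˢ n (im-i^ ∘ ∣_∣)

re-[1+i]^-suc : ∀ n → re-[1+i]^ (suc n) ≡ ℤ.- im-[1+i]^ n ℤ.+ re-[1+i]^ n
re-[1+i]^-suc n = cong (ℤ._+ re-[1+i]^ n) (trans (∑ˢ-cong n (re-i^-suc ∘ ∣_∣)) (∑ˢ-neg n (im-i^ ∘ ∣_∣)))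

im-[1+i]^-suc : ∀ n → im-[1+i]^ (suc n) ≡ re-[1+i]^ n ℤ.+ im-[1+i]^ n
im-[1+i]^-suc n = cong (ℤ._+ im-[1+i]^ n) (∑ˢ-cong n (im-i^-suc ∘ ∣_∣))

im-[1+i]^-+2 : ∀ n → im-[1+i]^ (2 + n) ≡ ℤ.+ 2 ℤ.* re-[1+i]^ n
im-[1+i]^-+2 n rewrite im-[1+i]^-suc (suc n) | re-[1+i]^-suc n | im-[1+i]^-suc n =
  double (re-[1+i]^ n) (im-[1+i]^ n)
  where
  double : ∀ a b → (ℤ.- b ℤ.+ a) ℤ.+ (a ℤ.+ b) ≡ ℤ.+ 2 ℤ.* a
  double = ℤ-Solver.solve-∀

re-[1+i]^-+2 : ∀ n → re-[1+i]^ (2 + n) ≡ ℤ.-[1+ 1 ] ℤ.* im-[1+i]^ n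
re-[1+i]^-+2 n rewrite re-[1+i]^-suc (suc n) | re-[1+i]^-suc n | im-[1+i]^-suc n =
  double (re-[1+i]^ n) (im-[1+i]^ n)
  where
  double : ∀ a b → ℤ.- (a ℤ.+ b) ℤ.+ (ℤ.- b ℤ.+ a) ≡ ℤ.-[1+ 1 ] ℤ.* b
  double = ℤ-Solver.solve-∀

im-[1+i]^-+4 : ∀ n → im-[1+i]^ (4 + n) ≡ ℤ.-[1+ 3 ] ℤ.* im-[1+i]^ n
im-[1+i]^-+4 n = begin
  im-[1+i]^ (4 + n)                              ≡⟨ im-[1+i]^-+2 (2 + n) ⟩
  ℤ.+ 2 ℤ.* re-[1+i]^ (2 + n)                    ≡⟨ cong (ℤ.+ 2 ℤ.*_) (re-[1+i]^-+2 n) ⟩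
  ℤ.+ 2 ℤ.* (ℤ.-[1+ 1 ] ℤ.* im-[1+i]^ n)         ≡⟨ ℤ.*-assoc (ℤ.+ 2) ℤ.-[1+ 1 ] (im-[1+i]^ n) ⟨
  ℤ.-[1+ 3 ] ℤ.* im-[1+i]^ n                     ∎

im-[1+i]^≢0 : ∀ n → n % 4 ≡ 2 → im-[1+i]^ n ≢ ℤ.0ℤ
im-[1+i]^≢0 2 _ ()
im-[1+i]^≢0 (suc (suc (suc (suc n)))) n+4%4≡2 im≡0 = im-[1+i]^≢0 n (trans (sym ([4+m]%4≡m%4 n)) n+4%4≡2)
  (ℤ.*-cancelˡ-≡ ℤ.-[1+ 3 ] (im-[1+i]^ n) ℤ.0ℤ (trans (sym (im-[1+i]^-+4 n)) im≡0))

i≡-i⇒i≡0 : ∀ {i} → i ≡ ℤ.- i → i ≡ ℤ.0ℤ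
i≡-i⇒i≡0 {ℤ.+ zero} _ = refl

module _ {n} (A : Fin n → Fin n → ℕ) (A-sym : ∀ u v → A u v ≡ A v u)
  (gram-diag : ∀ u → gram A u u % 4 ≡ 3) (gram-off : ∀ u v → u ≢ v → gram A u v % 2 ≡ 0) where

  mulMod2 : Subset n → Subset n
  mulMod2 y = tabulate (λ k → isOdd ((χ y · A) k))

  χ-mulMod2 : ∀ y k → χ (mulMod2 y) k ≡ (χ y · A) k % 2
  χ-mulMod2 y k = trans (cong 𝟙 (lookup∘tabulate _ k)) (𝟙-isOdd ((χ y · A) k))

  gram%2≡δ%2 : ∀ u k → gram A u k % 2 ≡ δ u k % 2
  gram%2≡δ%2 u k with u ≟ k
  ... | yes refl = m%4≡3⇒m%2≡1 (gram A u u) (gram-diag u)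
  ... | no u≢k   = gram-off u k u≢k

  mulMod2-involutive : ∀ y → mulMod2 (mulMod2 y) ≡ y
  mulMod2-involutive y = trans (tabulate-cong bit) (tabulate∘lookup y)
    where
    χ-mulMod2%2 : ∀ v → χ (mulMod2 y) v % 2 ≡ (χ y · A) v % 2
    χ-mulMod2%2 v = trans (cong (_% 2) (χ-mulMod2 y v)) (m%n%n≡m%n ((χ y · A) v) 2)
    parity : ∀ k → (χ (mulMod2 y) · A) k % 2 ≡ χ y k % 2
    parity k = begin
      (χ (mulMod2 y) · A) k % 2
        ≡⟨ sum-mod-cong (λ v → *-mod-cong {a = χ (mulMod2 y) v} {b = (χ y · A) v} {c = A v k} {e = A v k}
                                          (χ-mulMod2%2 v) refl) ⟩
      ((χ y · A) · A) k % 2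
        ≡⟨ cong (_% 2) (·-·-symmetric A A-sym (χ y) k) ⟩
      (χ y · gram A) k % 2
        ≡⟨ sum-mod-cong (λ u → *-mod-cong {a = χ y u} {b = χ y u} {c = gram A u k} {e = δ u k}
                                          refl (gram%2≡δ%2 u k)) ⟩
      (χ y · δ) k % 2
        ≡⟨ cong (_% 2) (·-identityʳ (χ y) k) ⟩
      χ y k % 2 ∎
    bit : ∀ k → isOdd ((χ (mulMod2 y) · A) k) ≡ lookup y k
    bit k = trans (cong (_≡ᵇ 1) (parity k)) (isOdd-𝟙 (lookup y k))

  ∣mulMod2∣%4 : ∀ y → ∣ mulMod2 y ∣ % 4 ≡ (∣ y ∣ * 3) % 4
  ∣mulMod2∣%4 y = begin
    ∣ mulMod2 y ∣ % 4                                   ≡⟨ cong (_% 4) (∣∣≡∑χ (mulMod2 y)) ⟩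
    (∑[ k < n ] χ (mulMod2 y) k) % 4                    ≡⟨ sum-mod-cong square ⟩
    (∑[ k < n ] ((x · A) k * (x · A) k)) % 4            ≡⟨ cong (_% 4) (∑·²≡∑∑gram A x) ⟩
    (∑[ u < n ] ∑[ v < n ] (x u * x v * gram A u v)) % 4 ≡⟨ ∑∑%4≡trace%4 _ symmetric even ⟩
    (∑[ u < n ] (x u * x u * gram A u u)) % 4           ≡⟨ sum-mod-cong diagonal ⟩
    (∑[ u < n ] (x u * 3)) % 4                          ≡⟨ cong (_% 4) (*-distribʳ-sum 3 x) ⟨
    (∑[ u < n ] x u * 3) % 4                            ≡⟨ cong (λ s → (s * 3) % 4) (∣∣≡∑χ y) ⟨
    (∣ y ∣ * 3) % 4                                     ∎
    where
    x : Fin n → ℕ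
    x = χ y
    square : ∀ k → χ (mulMod2 y) k % 4 ≡ ((x · A) k * (x · A) k) % 4
    square k = begin
      χ (mulMod2 y) k % 4  ≡⟨ cong (_% 4) (χ-mulMod2 y k) ⟩
      m % 2 % 4            ≡⟨ m<n⇒m%n≡m (≤-trans (m%n<n m 2) (s≤s (s≤s z≤n))) ⟩
      m % 2                ≡⟨ m*m%4≡m%2 m ⟨
      (m * m) % 4          ∎
      where
      m : ℕ
      m = (x · A) k
    symmetric : ∀ u v → x u * x v * gram A u v ≡ x v * x u * gram A v u
    symmetric u v = cong₂ _*_ (*-comm (x u) (x v)) (gram-sym A u v)
    even : ∀ u v → u ≢ v → 2 ∣ x u * x v * gram A u v
    even u v u≢v = ∣n⇒∣m*n (x u * x v) (m%n≡0⇒n∣m _ 2 (gram-off u v u≢v))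
    diagonal : ∀ u → (x u * x u * gram A u u) % 4 ≡ (x u * 3) % 4
    diagonal u = *-mod-cong {a = x u * x u} {b = x u} {c = gram A u u} {e = 3}
                            (cong (_% 4) (𝟙-idem (lookup y u))) (gram-diag u)

  mulMod2-↔ : Subset n ↔ Subset n
  mulMod2-↔ = mk↔ₛ′ mulMod2 mulMod2 mulMod2-involutive mulMod2-involutive

  im-[1+i]^≡0 : im-[1+i]^ n ≡ ℤ.0ℤ
  im-[1+i]^≡0 = i≡-i⇒i≡0 (begin
    im-[1+i]^ n                   ≡⟨ ∑ˢ-reindex n mulMod2-↔ (im-i^ ∘ ∣_∣) ⟨
    ∑ˢ n (im-i^ ∘ ∣_∣ ∘ mulMod2)  ≡⟨ ∑ˢ-cong n conjugate ⟩
    ∑ˢ n (λ y → ℤ.- im-i^ ∣ y ∣)  ≡⟨ ∑ˢ-neg n (im-i^ ∘ ∣_∣) ⟩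
    ℤ.- im-[1+i]^ n               ∎)
    where
    conjugate : ∀ y → im-i^ ∣ mulMod2 y ∣ ≡ ℤ.- im-i^ ∣ y ∣
    conjugate y = trans (im-i^-cong {∣ mulMod2 y ∣} {∣ y ∣ * 3} (∣mulMod2∣%4 y)) (im-i^-*3 ∣ y ∣)

length-filterᵇ-tabulate : ∀ {A : Set} {n} (p : A → Bool) (f : Fin n → A) →
  length (filterᵇ p (List.tabulate f)) ≡ ∑[ k < n ] 𝟙 (p (f k))
length-filterᵇ-tabulate {n = zero}  p f = refl
length-filterᵇ-tabulate {n = suc n} p f with p (f zero)
... | true  = cong suc (length-filterᵇ-tabulate p (f ∘ suc))
... | false = length-filterᵇ-tabulate p (f ∘ suc)

adjacency : ∀ {n} → SimpleGraph n → Fin n → Fin n → ℕ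
adjacency G u v = 𝟙 (adj G u v)

degree≡gram : ∀ {n} (G : SimpleGraph n) u → degree G u ≡ gram (adjacency G) u u
degree≡gram G u =
  trans (length-filterᵇ-tabulate (adj G u) id) (sum-cong-≗ (λ k → sym (𝟙-idem (adj G u k))))

commonNbrs≡gram : ∀ {n} (G : SimpleGraph n) u v → commonNbrs G u v ≡ gram (adjacency G) u v
commonNbrs≡gram G u v = trans (length-filterᵇ-tabulate (λ k → adj G u k ∧ adj G v k) id)
                              (sum-cong-≗ (λ k → 𝟙-∧ (adj G u k) (adj G v k)))

mainTheorem11 : (n : ℕ) → n % 4 ≡ 2 → (G : SimpleGraph n) →
    (∀ v → degree G v % 2 ≡ 1) →
    (∀ i j → i ≢ j → commonNbrs G i j % 2 ≡ 0) →
    ∃ λ v → degree G v % 4 ≡ 1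
mainTheorem11 n n%4≡2 G odd-degrees even-codegrees with any? (λ v → degree G v % 4 ℕ.≟ 1)
... | yes found = found
... | no  none  = contradiction (im-[1+i]^≡0 A A-sym gram-diag gram-off) (im-[1+i]^≢0 n n%4≡2)
  where
  A : Fin n → Fin n → ℕ
  A = adjacency G
  A-sym : ∀ u v → A u v ≡ A v u
  A-sym u v = cong 𝟙 (adj-sym G u v)
  gram-diag : ∀ u → gram A u u % 4 ≡ 3
  gram-diag u = begin
    gram A u u % 4   ≡⟨ cong (_% 4) (degree≡gram G u) ⟨
    degree G u % 4   ≡⟨ m%2≡1∧m%4≢1⇒m%4≡3 (degree G u) (odd-degrees u) (λ d≡1 → none (u , d≡1)) ⟩
    3                ∎
  gram-off : ∀ u v → u ≢ v → gram A u v % 2 ≡ 0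
  gram-off u v u≢v = trans (cong (_% 2) (sym (commonNbrs≡gram G u v))) (even-codegrees u v u≢v)
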